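{- Let $T=(\Sigma,E)$ be a graded nominal theory, let $X$ be a nominal set, and suppose that the judgement $X\vdash_m t=u$ (with $t,u\in\mathsf{Term}_{\Sigma,m}(X)$) is derivable in $T$. Then for every $n\le\omega$, every $(T,n)$-model satisfies $X\vdash_m t=u$.
   Context: Nominal sets: fix a countably infinite set $\mathbb{A}$ of names and let $G$ be the group of finite permutations of $\mathbb{A}$; $(a\,b)$ is the transposition of $a,b$. A nominal set is a set $X$ with a left $G$-action $(\pi,x)\mapsto\pi\cdot x$ such that every $x$ has a finite support, i.e. a finite $S\subseteq\mathbb{A}$ such that $\pi\cdot x=x$ for every $\pi\in G$ fixing $S$ pointwise; $\mathsf{supp}(x)$ is the least such $S$, and $a\# x$ means $a\notin\mathsf{supp}(x)$. A map $f$ between nominal sets is equivariant if $f(\pi\cdot x)=\pi\cdot f(x)$. A nominal set is orbit-finite if it has finitely many orbits. $\mathbb{A}$ is a nominal set via $\pi\cdot a=\pi(a)$; products carry the componentwise action. For a nominal set $X$, $[\mathbb{A}]X$ is the quotient of $\mathbb{A}\times X$ by $(a,x)\sim(b,y)$ iff $(c\,a)\cdot x=(c\,b)\cdot y$ for some $c$ fresh for $a,b,x,y$; the class of $(a,x)$ is written $\langle a\rangle x$, and $\pi\cdot\langle a\rangle x=\langle \pi(a)\rangle(\pi\cdot x)$. Signatures and terms: a nominal graded signature $\Sigma$ is a disjoint union of sets $\Sigma_0$ (pure), $\Sigma_{\mathsf f}$ (free) and $\Sigma_{\mathsf b}$ (bound) of operations, each $f$ having an arity $\mathsf{ar}(f)\in\mathbb{N}$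 and a depth $d(f)\in\mathbb{N}$. For a nominal set $X$ of variables, terms are given by $t::=x\mid f(t_1,\dots,t_p)\mid a.g(t_1,\dots,t_p)\mid \nu a.h(t_1,\dots,t_p)$ with $x\in X$, $a\in\mathbb{A}$, $f\in\Sigma_0$, $g\in\Sigma_{\mathsf f}$, $h\in\Sigma_{\mathsf b}$ of arity $p$. We write $\eta.f(t_1,\dots,t_p)$ generically, the prefix $\eta$ being empty, $a$, or $\nu a$ according to whether $f\in\Sigma_0,\Sigma_{\mathsf f},\Sigma_{\mathsf b}$. Uniform depth: variables have uniform depth $0$; $\eta.f(t_1,\dots,t_p)$ has uniform depth $m+d(f)$ whenever all $t_i$ have uniform depth $m$. $\mathsf{Term}_{\Sigma,m}(X)$ is the set of terms of uniform depth $m$; it is a nominal set under $\pi\cdot x$ (action of $X$), $\pi\cdot f(\vec t)=f(\pi\cdot\vec t)$, $\pi\cdot a.g(\vec t)=\pi(a).g(\pi\cdot \vec t)$, $\pi\cdot\nu a.h(\vec t)=\nu\pi(a).h(\pi\cdot\vec t)$ (terms are raw, not quotiented). A substitution $\sigma\colon Y\to\mathsf{Term}_{\Sigma,l}(X)$ acts on terms by $t\sigma$ = replace each variable $y$ by $\sigma(y)$, without renaming bound names. Theories and derivations: a depth-$n$ equation $X\vdash_n t=u$ consists of an orbit-finite nominal set $X$ and $t,u\in\mathsf{Term}_{\Sigma,n}(X)$. A graded theory $T=(\Sigma,E)$ is a signature with a set $E$ of equations (axioms). Derivable judgements $X\vdash_m t=u$ ($X$ a nominal set, $t,u\in \mathsf{Term}_{\Sigma,m}(X)$)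 are the least set closed under: (refl) $X\vdash_0 x=x$ for $x\in X$; (symm) from $X\vdash_m u=t$ infer $X\vdash_m t=u$; (trans) from $X\vdash_m t=v$ and $X\vdash_m v=u$ infer $X\vdash_m t=u$; (cong) from $X\vdash_m t_i=u_i$ ($i=1..p$) infer $X\vdash_{m+d(f)}\eta.f(t_1,..,t_p)=\eta.f(u_1,..,u_p)$ for $f\in\Sigma$ of arity $p$; (ax) for an axiom $Y\vdash_m r=s$ in $E$, $\tau\in G$ and $\sigma\colon Y\to \mathsf{Term}_{\Sigma,l}(X)$ such that $X\vdash_l \pi\cdot\sigma(y)=\sigma(\pi\cdot y)$ is derivable for all $\pi\in G$, $y\in Y$, infer $X\vdash_{m+l}(\tau\cdot r)\sigma=(\tau\cdot s)\sigma$; (perm) for $h\in\Sigma_{\mathsf b}$ of arity $p$ and names $a\ne b$ with $a\# u_i$ for all $i$, from $X\vdash_m t_i=(a\,b)\cdot u_i$ ($i=1..p$) infer $X\vdash_{m+d(h)}\nu a.h(t_1,..,t_p)=\nu b.h(u_1,..,u_p)$. Algebras and models: for $n\le\omega$, a nominal $(\Sigma,n)$-algebra $A$ consists of nominal sets $A_i$ ($0\le i\le n$, resp. $i<\omega$ if $n=\omega$) and, for each $f\in\Sigma$ of arity $p$ and each $m$ with $m+d(f)\le n$ (all $m$ if $n=\omega$), an equivariant map $f_{A,m}$ of type $A_m^p\to A_{m+d(f)}$ if $f\in\Sigma_0$, $\mathbb{A}\times A_m^p\to A_{m+d(f)}$ if $f\in\Sigma_{\mathsf f}$, $[\mathbb{A}](A_m^p)\to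 A_{m+d(f)}$ if $f\in\Sigma_{\mathsf b}$. For an equivariant valuation $\iota\colon X\to A_k$ and $t\in\mathsf{Term}_{\Sigma,m}(X)$ with $k+m\le n$, the value $[\![t]\!]^\iota_m\in A_{k+m}$ is defined by $[\![x]\!]^\iota_0=\iota(x)$, $[\![f(\vec t)]\!]^\iota_{m+d(f)}=f_{A,k+m}([\![t_1]\!]^\iota_m,\dots)$, $[\![a.f(\vec t)]\!]^\iota_{m+d(f)}=f_{A,k+m}(a,[\![t_1]\!]^\iota_m,\dots)$, $[\![\nu a.f(\vec t)]\!]^\iota_{m+d(f)}=f_{A,k+m}(\langle a\rangle([\![t_1]\!]^\iota_m,\dots,[\![t_p]\!]^\iota_m))$. $A$ satisfies $X\vdash_m t=u$ if $[\![t]\!]^\iota_m=[\![u]\!]^\iota_m$ for all $k$ with $k+m\le n$ and all equivariant $\iota\colon X\to A_k$. A $(T,n)$-model is a $(\Sigma,n)$-algebra satisfying every axiom in $E$. -}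

module Defs where

open import Data.Nat using (ℕ; zero; suc; _+_; _≤_; _≟_)
open import Data.Nat.Properties using (+-assoc; +-comm; +-identityʳ; m≤m+n; ≤-trans; ≤-reflexive)
open import Data.List using (List; []; _∷_; _++_)
open import Data.List.Membership.Propositional using (_∈_; _∉_)
open import Data.List.Membership.Propositional.Properties using (∈-++⁺ˡ; ∈-++⁺ʳ)
open import Data.List.Relation.Unary.Any using (here; there)
open import Data.Vec using (Vec; []; _∷_; lookup; map)
open import Data.Fin using (Fin)
open import Data.Product using (Σ; _×_; _,_; proj₁; proj₂)
open import Data.Unit using (⊤; tt)
open import Data.Empty using (⊥-elim)
open import Relation.Nullary using (¬_; yes; no)
open import Relation.Binary.PropositionalEquality
  using (_≡_; _≢_; refl; sym; trans; cong; subst)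

𝔸 : Set
𝔸 = ℕ

record Perm : Set where
  field
    fun    : 𝔸 → 𝔸
    inv    : 𝔸 → 𝔸
    inv-l  : ∀ a → inv (fun a) ≡ a
    inv-r  : ∀ a → fun (inv a) ≡ a
    finite : Σ (List 𝔸) λ S → ∀ a → a ∉ S → fun a ≡ a
open Perm public

idP : Perm
idP = record { fun = λ a → a ; inv = λ a → a ; inv-l = λ _ → refl
             ; inv-r = λ _ → refl ; finite = [] , λ _ _ → refl }

_∘P_ : Perm → Perm → Perm
π ∘P ρ = record
  { fun = λ a → fun π (fun ρ a)
  ; inv = λ a → inv ρ (inv π a)
  ; inv-l = λ a → trans (cong (inv ρ) (inv-l π (fun ρ a))) (inv-l ρ a)
  ; inv-r = λ a → trans (cong (fun π) (inv-r ρ (inv π a))) (inv-r π a)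
  ; finite = (proj₁ (finite ρ) ++ proj₁ (finite π)) , fin
  }
  where
  fin : ∀ a → a ∉ (proj₁ (finite ρ) ++ proj₁ (finite π)) → fun π (fun ρ a) ≡ a
  fin a a∉ = trans (cong (fun π) eρ) (proj₂ (finite π) a (λ i → a∉ (∈-++⁺ʳ _ i)))
    where eρ = proj₂ (finite ρ) a (λ i → a∉ (∈-++⁺ˡ i))

swapFun : 𝔸 → 𝔸 → 𝔸 → 𝔸
swapFun a b c with c ≟ a
... | yes _ = b
... | no _ with c ≟ b
...   | yes _ = a
...   | no _ = c

swapFun-invol : ∀ a b c → swapFun a b (swapFun a b c) ≡ c
swapFun-invol a b c with c ≟ a
swapFun-invol a b c | yes c≡a with b ≟ a
... | yes b≡a = trans b≡a (sym c≡a)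
... | no _ with b ≟ b
...   | yes _ = sym c≡a
...   | no b≢b = ⊥-elim (b≢b refl)
swapFun-invol a b c | no c≢a with c ≟ b
swapFun-invol a b c | no c≢a | yes c≡b with a ≟ a
... | yes _ = sym c≡b
... | no a≢a = ⊥-elim (a≢a refl)
swapFun-invol a b c | no c≢a | no c≢b with c ≟ a
... | yes c≡a = ⊥-elim (c≢a c≡a)
... | no _ with c ≟ b
...   | yes c≡b = ⊥-elim (c≢b c≡b)
...   | no _ = refl

swapFun-fix : ∀ a b c → c ∉ (a ∷ b ∷ []) → swapFun a b c ≡ c
swapFun-fix a b c c∉ with c ≟ a
... | yes c≡a = ⊥-elim (c∉ (here c≡a))
... | no _ with c ≟ b
...   | yes c≡b = ⊥-elim (c∉ (there (here c≡b)))
...   | no _ = refl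

swap : 𝔸 → 𝔸 → Perm
swap a b = record
  { fun = swapFun a b ; inv = swapFun a b
  ; inv-l = swapFun-invol a b ; inv-r = swapFun-invol a b
  ; finite = (a ∷ b ∷ []) , swapFun-fix a b }

Supports : {C : Set} → (Perm → C → C) → List 𝔸 → C → Set
Supports act S x = ∀ π → (∀ a → a ∈ S → fun π a ≡ a) → act π x ≡ x

-- a # x : a ∉ supp(x), i.e. x has a finite support not containing a
-- (equivalent, since supp(x) is the least finite support of x)
Fresh : {C : Set} → (Perm → C → C) → 𝔸 → C → Set
Fresh act a x = Σ (List 𝔸) λ S → (a ∉ S) × Supports act S x

record NomSet : Set₁ where
  field
    Carrier : Set
    act     : Perm → Carrier → Carrier
    act-id  : ∀ x → act idP x ≡ x
    act-∘   : ∀ π ρ x → act (π ∘P ρ) x ≡ act π (act ρ x)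
    -- the action is an action of the group G: it only depends on the
    -- permutation as a function on names
    act-ext : ∀ π ρ → (∀ a → fun π a ≡ fun ρ a) → ∀ x → act π x ≡ act ρ x
    finSupp : ∀ x → Σ (List 𝔸) λ S → Supports act S x
open NomSet public

vact : {C : Set} → (Perm → C → C) → {p : ℕ} → Perm → Vec C p → Vec C p
vact act π xs = map (act π) xs

OrbitFinite : NomSet → Set
OrbitFinite X = Σ (List (Carrier X)) λ ys →
  ∀ y → Σ Perm λ π → Σ (Carrier X) λ y' → (y' ∈ ys) × (act X π y' ≡ y)

data Kind : Set where
  pure free bound : Kind

record Signature : Set₁ where
  field
    Op  : Kind → Set          -- Σ₀ = Op pure, Σ_f = Op free, Σ_b = Op bound
    ar  : ∀ {κ} → Op κ → ℕ
    dep : ∀ {κ} → Op κ → ℕ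
open Signature public

data Term (Sig : Signature) (X : Set) : ℕ → Set where
  var  : X → Term Sig X 0
  op   : ∀ {m} (f : Op Sig pure) → Vec (Term Sig X m) (ar Sig f) → Term Sig X (m + dep Sig f)
  fop  : ∀ {m} (g : Op Sig free) → 𝔸 → Vec (Term Sig X m) (ar Sig g) → Term Sig X (m + dep Sig g)
  νop  : ∀ {m} (h : Op Sig bound) → 𝔸 → Vec (Term Sig X m) (ar Sig h) → Term Sig X (m + dep Sig h)

module _ {Sig : Signature} {X : Set} (actX : Perm → X → X) where
  mutual
    -- permutation action on terms (raw, no α-quotient)
    tact : ∀ {m} → Perm → Term Sig X m → Term Sig X m
    tact π (var x)      = var (actX π x)
    tact π (op f ts)    = op f (tacts π ts)
    tact π (fop g a ts) = fop g (fun π a) (tacts π ts)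
    tact π (νop h a ts) = νop h (fun π a) (tacts π ts)

    tacts : ∀ {m p} → Perm → Vec (Term Sig X m) p → Vec (Term Sig X m) p
    tacts π []       = []
    tacts π (t ∷ ts) = tact π t ∷ tacts π ts

+-shuffle : ∀ m l d → m + l + d ≡ m + d + l
+-shuffle m l d = trans (+-assoc m l d)
  (trans (cong (m +_) (+-comm l d)) (sym (+-assoc m d l)))

module _ {Sig : Signature} {Y X : Set} {l : ℕ} (σ : Y → Term Sig X l) where
  mutual
    -- substitution tσ (no renaming of bound names); depth m ↦ m + l
    _⟪σ⟫ : ∀ {m} → Term Sig Y m → Term Sig X (m + l)
    var y ⟪σ⟫ = σ y
    _⟪σ⟫ (op {m} f ts) =
      subst (Term Sig X) (+-shuffle m l (dep Sig f)) (op f (ts ⟪σ⟫s))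
    _⟪σ⟫ (fop {m} g a ts) =
      subst (Term Sig X) (+-shuffle m l (dep Sig g)) (fop g a (ts ⟪σ⟫s))
    _⟪σ⟫ (νop {m} h a ts) =
      subst (Term Sig X) (+-shuffle m l (dep Sig h)) (νop h a (ts ⟪σ⟫s))

    _⟪σ⟫s : ∀ {m p} → Vec (Term Sig Y m) p → Vec (Term Sig X (m + l)) p
    [] ⟪σ⟫s = []
    (t ∷ ts) ⟪σ⟫s = (t ⟪σ⟫) ∷ (ts ⟪σ⟫s)

_[_] : ∀ {Sig : Signature} {Y X : Set} {l m} → Term Sig Y m → (Y → Term Sig X l) → Term Sig X (m + l)
t [ σ ] = _⟪σ⟫ σ t

record Equation (Sig : Signature) : Set₁ where
  field
    Vars    : NomSet
    orbFin  : OrbitFinite Vars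
    depth   : ℕ
    lhs rhs : Term Sig (Carrier Vars) depth
open Equation public

record Theory : Set₁ where
  field
    sig  : Signature
    Ax   : Set
    axiom : Ax → Equation sig
open Theory public

data Derivable (T : Theory) (X : NomSet) :
       (m : ℕ) → Term (sig T) (Carrier X) m → Term (sig T) (Carrier X) m → Set where
  drefl  : ∀ x → Derivable T X 0 (var x) (var x)
  dsymm  : ∀ {m t u} → Derivable T X m u t → Derivable T X m t u
  dtrans : ∀ {m t v u} → Derivable T X m t v → Derivable T X m v u → Derivable T X m t u
  dcong₀ : ∀ {m} (f : Op (sig T) pure) (ts us : Vec _ (ar (sig T) f)) →
           (∀ i → Derivable T X m (lookup ts i) (lookup us i)) →
           Derivable T X (m + dep (sig T) f) (op f ts) (op f us)
  dcongf : ∀ {m} (g : Op (sig T) free) (a : 𝔸) (ts us : Vec _ (ar (sig T) g)) →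
           (∀ i → Derivable T X m (lookup ts i) (lookup us i)) →
           Derivable T X (m + dep (sig T) g) (fop g a ts) (fop g a us)
  dcongb : ∀ {m} (h : Op (sig T) bound) (a : 𝔸) (ts us : Vec _ (ar (sig T) h)) →
           (∀ i → Derivable T X m (lookup ts i) (lookup us i)) →
           Derivable T X (m + dep (sig T) h) (νop h a ts) (νop h a us)
  dax    : (e : Ax T) (τ : Perm) (l : ℕ)
           (σ : Carrier (Vars (axiom T e)) → Term (sig T) (Carrier X) l) →
           (∀ π y → Derivable T X l (tact (act X) π (σ y))
                                    (σ (act (Vars (axiom T e)) π y))) →
           Derivable T X (depth (axiom T e) + l)
             (tact (act (Vars (axiom T e))) τ (lhs (axiom T e)) [ σ ])
             (tact (act (Vars (axiom T e))) τ (rhs (axiom T e)) [ σ ])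
  dperm  : ∀ {m} (h : Op (sig T) bound) (a b : 𝔸) (ts us : Vec _ (ar (sig T) h)) →
           a ≢ b →
           (∀ i → Fresh (tact (act X)) a (lookup us i)) →
           (∀ i → Derivable T X m (lookup ts i) (tact (act X) (swap a b) (lookup us i))) →
           Derivable T X (m + dep (sig T) h) (νop h a ts) (νop h b us)

data Bound : Set where
  fin : ℕ → Bound
  ω   : Bound

infix 4 _≤B_
_≤B_ : ℕ → Bound → Set
i ≤B fin n = i ≤ n
i ≤B ω     = ⊤

≤B-mono : ∀ {i j : ℕ} {n : Bound} → i ≤ j → j ≤B n → i ≤B n
≤B-mono {n = fin n} i≤j j≤n = ≤-trans i≤j j≤n
≤B-mono {n = ω}     _   _   = tt

≤B-+ˡ : ∀ {i j : ℕ} {n : Bound} → i + j ≤B n → i ≤B n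
≤B-+ˡ {i} {j} = ≤B-mono (m≤m+n i j)

≤B-≡ : ∀ {i j : ℕ} {n : Bound} → i ≡ j → j ≤B n → i ≤B n
≤B-≡ e = ≤B-mono (≤-reflexive e)

-- Bound operations [𝔸](A_m^p) → A_{m+d} are given as maps on 𝔸 × A_m^p
-- that respect the relation ~ defining [𝔸](A_m^p).
record Algebra (Sig : Signature) (n : Bound) : Set₁ where
  field
    A : (i : ℕ) → .(i ≤B n) → NomSet

  C : (i : ℕ) → .(i ≤B n) → Set
  C i p = Carrier (A i p)

  field
    op₀ : (f : Op Sig pure) (m : ℕ) .(p : m + dep Sig f ≤B n) →
          Vec (C m (≤B-+ˡ p)) (ar Sig f) → C (m + dep Sig f) p
    op₀-equiv : ∀ f m .(p : m + dep Sig f ≤B n) π xs →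
          op₀ f m p (vact (act (A m (≤B-+ˡ p))) π xs) ≡ act (A _ p) π (op₀ f m p xs)
    opf : (g : Op Sig free) (m : ℕ) .(p : m + dep Sig g ≤B n) →
          𝔸 → Vec (C m (≤B-+ˡ p)) (ar Sig g) → C (m + dep Sig g) p
    opf-equiv : ∀ g m .(p : m + dep Sig g ≤B n) π a xs →
          opf g m p (fun π a) (vact (act (A m (≤B-+ˡ p))) π xs)
            ≡ act (A _ p) π (opf g m p a xs)
    opb : (h : Op Sig bound) (m : ℕ) .(p : m + dep Sig h ≤B n) →
          𝔸 → Vec (C m (≤B-+ˡ p)) (ar Sig h) → C (m + dep Sig h) p
    opb-α : ∀ h m .(p : m + dep Sig h ≤B n) a b xs ys c →
          c ≢ a → c ≢ b →
          Fresh (vact (act (A m (≤B-+ˡ p)))) c xs →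
          Fresh (vact (act (A m (≤B-+ˡ p)))) c ys →
          vact (act (A m (≤B-+ˡ p))) (swap c a) xs ≡ vact (act (A m (≤B-+ˡ p))) (swap c b) ys →
          opb h m p a xs ≡ opb h m p b ys
    -- equivariance w.r.t. π · ⟨a⟩xs = ⟨π a⟩(π · xs)
    opb-equiv : ∀ h m .(p : m + dep Sig h ≤B n) π a xs →
          opb h m p (fun π a) (vact (act (A m (≤B-+ˡ p))) π xs)
            ≡ act (A _ p) π (opb h m p a xs)

  cast : ∀ {i j} → i ≡ j → .(p : i ≤B n) .(q : j ≤B n) → C i p → C j q
  cast refl p q x = x

open Algebra public

Equivariant : (X Y : NomSet) → (Carrier X → Carrier Y) → Set
Equivariant X Y f = ∀ π x → f (act X π x) ≡ act Y π (f x)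

module Eval {Sig : Signature} {n : Bound} (𝒜 : Algebra Sig n) {X : Set}
            (k : ℕ) .(pk : k ≤B n) (ι : X → C 𝒜 k pk) where
  mutual
    ⟦_⟧ : ∀ {m} (t : Term Sig X m) .(q : k + m ≤B n) → C 𝒜 (k + m) q
    ⟦ var x ⟧ q = cast 𝒜 (sym (+-identityʳ k)) pk q (ι x)
    ⟦ op {m} f ts ⟧ q =
      cast 𝒜 (+-assoc k m (dep Sig f)) (≤B-≡ (+-assoc k m (dep Sig f)) q) q
        (op₀ 𝒜 f (k + m) (≤B-≡ (+-assoc k m (dep Sig f)) q) (⟦ ts ⟧s (≤B-+ˡ (≤B-≡ (+-assoc k m (dep Sig f)) q))))
    ⟦ fop {m} g a ts ⟧ q =
      cast 𝒜 (+-assoc k m (dep Sig g)) (≤B-≡ (+-assoc k m (dep Sig g)) q) q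
        (opf 𝒜 g (k + m) (≤B-≡ (+-assoc k m (dep Sig g)) q) a (⟦ ts ⟧s (≤B-+ˡ (≤B-≡ (+-assoc k m (dep Sig g)) q))))
    ⟦ νop {m} h a ts ⟧ q =
      cast 𝒜 (+-assoc k m (dep Sig h)) (≤B-≡ (+-assoc k m (dep Sig h)) q) q
        (opb 𝒜 h (k + m) (≤B-≡ (+-assoc k m (dep Sig h)) q) a (⟦ ts ⟧s (≤B-+ˡ (≤B-≡ (+-assoc k m (dep Sig h)) q))))

    ⟦_⟧s : ∀ {m p} (ts : Vec (Term Sig X m) p) .(q : k + m ≤B n) → Vec (C 𝒜 (k + m) q) p
    ⟦ [] ⟧s q = []
    ⟦ t ∷ ts ⟧s q = ⟦ t ⟧ q ∷ ⟦ ts ⟧s q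

Satisfies : ∀ {Sig : Signature} {n : Bound} → Algebra Sig n → (X : NomSet) (m : ℕ) →
            Term Sig (Carrier X) m → Term Sig (Carrier X) m → Set
Satisfies {n = n} 𝒜 X m t u =
  ∀ k .(q : k + m ≤B n) (ι : Carrier X → C 𝒜 k (≤B-+ˡ q)) →
  Equivariant X (A 𝒜 k (≤B-+ˡ q)) ι →
  Eval.⟦_⟧ 𝒜 k (≤B-+ˡ q) ι t q ≡ Eval.⟦_⟧ 𝒜 k (≤B-+ˡ q) ι u q

record Model (T : Theory) (n : Bound) : Set₁ where
  field
    alg    : Algebra (sig T) n
    sat-ax : ∀ e → Satisfies alg (Vars (axiom T e)) (depth (axiom T e))
                     (lhs (axiom T e)) (rhs (axiom T e))
open Model public

-- Evaluation under an equivariant valuation is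
-- equivariant, so satisfaction survives permuting both sides of an equation (the τ of
-- (ax)); the value of t[σ] is the value of t under the valuation y ↦ ⟦σ y⟧, which the
-- premise of (ax) makes equivariant, so the axiom applies to it; and (perm) is sound
-- because bound operations are defined on [𝔸](A^p), where ⟨a⟩((a b)·ys) = ⟨b⟩ys as soon
-- as a # ys. Everything else is transport of values along depth equations such as
-- k + (m + l) = (k + l) + m.
module Submission where

open import Defs
open import Data.Nat using (ℕ; suc; _+_; _≟_)
open import Data.Nat.Properties using (+-assoc; +-comm; m≤n+m; +-monoʳ-≤; n≮n; ≡-irrelevant)
open import Data.List as List using (List; []; _∷_; _++_)
open import Data.List.Extrema.Nat using (max; xs≤max)
open import Data.List.Membership.Propositional using (_∈_; _∉_)
open import Data.List.Membership.Propositional.Properties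
  using (∈-++⁺ˡ; ∈-++⁺ʳ; ∈-++⁻; ∈-map⁺; ∈-map⁻)
open import Data.List.Relation.Unary.All as All using ()
open import Data.List.Relation.Unary.Any using (here; there)
open import Data.Vec using (Vec; []; _∷_; lookup; map)
open import Data.Vec.Properties using (map-id; map-cong; map-∘)
open import Data.Fin using (zero; suc)
open import Data.Product using (Σ; _,_; proj₁; proj₂)
open import Data.Sum using ([_,_]′)
open import Relation.Nullary using (yes; no; contradiction)
open import Relation.Binary.PropositionalEquality
  using (_≡_; _≢_; refl; sym; trans; cong; cong₂; subst; module ≡-Reasoning)

invP : Perm → Perm
invP π = record
  { fun = inv π ; inv = fun π ; inv-l = inv-r π ; inv-r = inv-l π
  ; finite = proj₁ (finite π) , λ a a∉ →
      trans (cong (inv π) (sym (proj₂ (finite π) a a∉))) (inv-l π a) }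

fun-injective : ∀ π {a b} → fun π a ≡ fun π b → a ≡ b
fun-injective π {a} {b} πa≡πb = trans (sym (inv-l π a)) (trans (cong (inv π) πa≡πb) (inv-l π b))

swapFun-right : ∀ a b → swapFun a b b ≡ a
swapFun-right a b with b ≟ a
... | yes b≡a = b≡a
... | no _ with b ≟ b
...   | yes _ = refl
...   | no b≢b = contradiction refl b≢b

swapFun-other : ∀ {a b c} → c ≢ a → c ≢ b → swapFun a b c ≡ c
swapFun-other {a} {b} {c} c≢a c≢b = swapFun-fix a b c λ
  { (here c≡a) → c≢a c≡a ; (there (here c≡b)) → c≢b c≡b }

swapFun-∘ : ∀ a b c {s} → s ≢ a → s ≢ c → swapFun c a (swapFun a b s) ≡ swapFun c b s
swapFun-∘ a b c {s} s≢a s≢c with s ≟ b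
... | yes refl = trans (cong (swapFun c a) (swapFun-right a s))
                       (trans (swapFun-right c a) (sym (swapFun-right c s)))
... | no s≢b = trans (cong (swapFun c a) (swapFun-other s≢a s≢b))
                     (trans (swapFun-other s≢c s≢a) (sym (swapFun-other s≢c s≢b)))

module _ (X : NomSet) where

  act-agree : ∀ {S x} → Supports (act X) S x → ∀ π ρ →
              (∀ s → s ∈ S → fun π s ≡ fun ρ s) → act X π x ≡ act X ρ x
  act-agree {S} {x} supp π ρ π≗ρ = begin
    act X π x
      ≡⟨ act-ext X π (ρ ∘P (invP ρ ∘P π)) (λ a → sym (inv-r ρ (fun π a))) x ⟩
    act X (ρ ∘P (invP ρ ∘P π)) x
      ≡⟨ act-∘ X ρ (invP ρ ∘P π) x ⟩
    act X ρ (act X (invP ρ ∘P π) x)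
      ≡⟨ cong (act X ρ) (supp (invP ρ ∘P π) ρ⁻¹π-fixes) ⟩
    act X ρ x
      ∎
    where
    open ≡-Reasoning
    ρ⁻¹π-fixes : ∀ s → s ∈ S → inv ρ (fun π s) ≡ s
    ρ⁻¹π-fixes s s∈S = trans (cong (inv ρ) (π≗ρ s s∈S)) (inv-l ρ s)

  Supports-act : ∀ {S x} π → Supports (act X) S x →
                 Supports (act X) (List.map (fun π) S) (act X π x)
  Supports-act {S} {x} π supp ρ ρ-fixes = begin
    act X ρ (act X π x)  ≡⟨ act-∘ X ρ π x ⟨
    act X (ρ ∘P π) x     ≡⟨ act-agree supp (ρ ∘P π) π (λ s s∈S → ρ-fixes (fun π s) (∈-map⁺ (fun π) s∈S)) ⟩
    act X π x            ∎
    where open ≡-Reasoning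

  Fresh-act : ∀ {a x} π → Fresh (act X) a x → Fresh (act X) (fun π a) (act X π x)
  Fresh-act {a} π (S , a∉S , supp) = List.map (fun π) S , πa∉πS , Supports-act π supp
    where
    πa∉πS : fun π a ∉ List.map (fun π) S
    πa∉πS πa∈ with ∈-map⁻ (fun π) πa∈
    ... | s , s∈S , πa≡πs = a∉S (subst (_∈ S) (sym (fun-injective π πa≡πs)) s∈S)


  swap-∘-act : ∀ {S x a c} b → Supports (act X) S x → a ∉ S → c ∉ S →
               act X (swap c a) (act X (swap a b) x) ≡ act X (swap c b) x
  swap-∘-act {S} {x} {a} {c} b supp a∉S c∉S = trans (sym (act-∘ X (swap c a) (swap a b) x))
    (act-agree supp (swap c a ∘P swap a b) (swap c b) λ s s∈S →
      swapFun-∘ a b c {s} (λ { refl → a∉S s∈S }) (λ { refl → c∉S s∈S }))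

fresh : List 𝔸 → 𝔸
fresh S = suc (max 0 S)

fresh-∉ : ∀ S → fresh S ∉ S
fresh-∉ S fresh∈S = n≮n (max 0 S) (All.lookup (xs≤max 0 S) fresh∈S)

module _ {C : Set} {actC : Perm → C → C} where

  Supports-∷ : ∀ {S S′ x p} {xs : Vec C p} → Supports actC S x → Supports (vact actC) S′ xs →
               Supports (vact actC) (S ++ S′) (x ∷ xs)
  Supports-∷ {S} supp supps π π-fixes =
    cong₂ _∷_ (supp π λ s s∈S → π-fixes s (∈-++⁺ˡ s∈S))
              (supps π λ s s∈S′ → π-fixes s (∈-++⁺ʳ S s∈S′))

  Fresh-vec : ∀ {a p} (xs : Vec C p) → (∀ i → Fresh actC a (lookup xs i)) → Fresh (vact actC) a xs
  Fresh-vec [] _ = [] , (λ ()) , λ _ _ → refl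
  Fresh-vec (x ∷ xs) a#xs with a#xs zero | Fresh-vec xs (λ i → a#xs (suc i))
  ... | S , a∉S , supp | S′ , a∉S′ , supps =
    S ++ S′ , (λ a∈ → [ a∉S , a∉S′ ]′ (∈-++⁻ S a∈)) , Supports-∷ supp supps

Vecᴺ : NomSet → ℕ → NomSet
Vecᴺ X p = record
  { Carrier = Vec (Carrier X) p
  ; act     = vact (act X)
  ; act-id  = λ xs → trans (map-cong (act-id X) xs) (map-id xs)
  ; act-∘   = λ π ρ xs → trans (map-cong (act-∘ X π ρ) xs) (map-∘ (act X π) (act X ρ) xs)
  ; act-ext = λ π ρ π≗ρ → map-cong (act-ext X π ρ π≗ρ)
  ; finSupp = finSupp-vec
  }
  where
  finSupp-vec : ∀ {p} (xs : Vec (Carrier X) p) → Σ (List 𝔸) λ S → Supports (vact (act X)) S xs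
  finSupp-vec [] = [] , λ _ _ → refl
  finSupp-vec (x ∷ xs) with finSupp X x | finSupp-vec xs
  ... | S , supp | S′ , supps = S ++ S′ , Supports-∷ supp supps

-- ⟨a⟩((a b)·ys) = ⟨b⟩ys in [𝔸](A_m^p): for c fresh, (c a)·(a b)·ys = (c b)·ys.
opb-rename : ∀ {Sig n} (𝒜 : Algebra Sig n) h m .(p : m + dep Sig h ≤B n) a b
             (ys : Vec (C 𝒜 m (≤B-+ˡ p)) (ar Sig h)) →
             Fresh (vact (act (A 𝒜 m (≤B-+ˡ p)))) a ys →
             opb 𝒜 h m p a (vact (act (A 𝒜 m (≤B-+ˡ p))) (swap a b) ys) ≡ opb 𝒜 h m p b ys
opb-rename {Sig} 𝒜 h m p a b ys (S , a∉S , supp) =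
  opb-α 𝒜 h m p a b xs ys c c≢a c≢b c#xs c#ys (swap-∘-act V b supp a∉S c∉S)
  where
  V : NomSet
  V = Vecᴺ (A 𝒜 m (≤B-+ˡ p)) (ar Sig h)
  xs : Carrier V
  xs = act V (swap a b) ys
  c : 𝔸
  c = fresh (a ∷ b ∷ S)
  c≢a : c ≢ a
  c≢a c≡a = fresh-∉ (a ∷ b ∷ S) (here c≡a)
  c≢b : c ≢ b
  c≢b c≡b = fresh-∉ (a ∷ b ∷ S) (there (here c≡b))
  c∉S : c ∉ S
  c∉S c∈S = fresh-∉ (a ∷ b ∷ S) (there (there c∈S))
  c#ys : Fresh (act V) c ys
  c#ys = S , c∉S , supp
  c#xs : Fresh (act V) c xs
  c#xs = subst (λ d → Fresh (act V) d xs) (swapFun-other c≢a c≢b) (Fresh-act V (swap a b) c#ys)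

module DepthCast {Sig : Signature} {n : Bound} (𝒜 : Algebra Sig n) where

  infix 4 _≋_ _≋s_

  _≋_ : ∀ {i j} .{p : i ≤B n} .{q : j ≤B n} → C 𝒜 i p → C 𝒜 j q → Set
  _≋_ {i} {j} {p} {q} x y = Σ (i ≡ j) λ i≡j → cast 𝒜 i≡j p q x ≡ y

  _≋s_ : ∀ {i j r} .{p : i ≤B n} .{q : j ≤B n} → Vec (C 𝒜 i p) r → Vec (C 𝒜 j q) r → Set
  _≋s_ {i} {j} {p = p} {q} xs ys = Σ (i ≡ j) λ i≡j → map (cast 𝒜 i≡j p q) xs ≡ ys

  cast-irrelevant : ∀ {i j} (e e′ : i ≡ j) .(p : i ≤B n) .(q : j ≤B n) x →
                    cast 𝒜 e p q x ≡ cast 𝒜 e′ p q x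
  cast-irrelevant e e′ p q x rewrite ≡-irrelevant e e′ = refl

  cast-act : ∀ {i j} (e : i ≡ j) .(p : i ≤B n) .(q : j ≤B n) π x →
             cast 𝒜 e p q (act (A 𝒜 i p) π x) ≡ act (A 𝒜 j q) π (cast 𝒜 e p q x)
  cast-act refl p q π x = refl

  ≋-cast : ∀ {i j} (e : i ≡ j) .(p : i ≤B n) .(q : j ≤B n) x → x ≋ cast 𝒜 e p q x
  ≋-cast e p q x = e , refl

  ≋-sym : ∀ {i j} .{p : i ≤B n} .{q : j ≤B n} {x : C 𝒜 i p} {y : C 𝒜 j q} → x ≋ y → y ≋ x
  ≋-sym (refl , refl) = refl , refl

  ≋-trans : ∀ {i j l} .{p : i ≤B n} .{q : j ≤B n} .{r : l ≤B n}
            {x : C 𝒜 i p} {y : C 𝒜 j q} {z : C 𝒜 l r} → x ≋ y → y ≋ z → x ≋ z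
  ≋-trans (refl , refl) (refl , refl) = refl , refl

  ≋⇒cast≡ : ∀ {i j} (e : i ≡ j) .{p : i ≤B n} .{q : j ≤B n} {x : C 𝒜 i p} {y : C 𝒜 j q} →
            x ≋ y → cast 𝒜 e p q x ≡ y
  ≋⇒cast≡ e (e′ , cast≡) = trans (cast-irrelevant e e′ _ _ _) cast≡

  ≋s-[] : ∀ {i j} .{p : i ≤B n} .{q : j ≤B n} → i ≡ j → _≋s_ {p = p} {q} [] []
  ≋s-[] i≡j = i≡j , refl

  ≋s-∷ : ∀ {i j r} .{p : i ≤B n} .{q : j ≤B n} {x : C 𝒜 i p} {y : C 𝒜 j q}
         {xs : Vec (C 𝒜 i p) r} {ys} → x ≋ y → xs ≋s ys → x ∷ xs ≋s y ∷ ys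
  ≋s-∷ (e , x≡y) (e′ , xs≡ys) =
    e , cong₂ _∷_ x≡y (trans (map-cong (cast-irrelevant e e′ _ _) _) xs≡ys)

  -- The common shape of op₀ f, opf g a and opb h a.
  Node : ℕ → ℕ → Set
  Node d r = ∀ i .(p : i + d ≤B n) → Vec (C 𝒜 i (≤B-+ˡ p)) r → C 𝒜 (i + d) p

  Node-≋ : ∀ {d r} (F : Node d r) {i j} .(p : i + d ≤B n) .(q : j + d ≤B n) {xs ys} →
           xs ≋s ys → F i p xs ≋ F j q ys
  Node-≋ F p q {xs} (refl , refl) = refl , cong (F _ q) (sym (map-id xs))

  cast-Node-≋ : ∀ {d r} (F : Node d r) {i j i′ j′} (e : i + d ≡ i′) (e′ : j + d ≡ j′)
                .{p : i + d ≤B n} .{p′ : j + d ≤B n} .{q : i′ ≤B n} .{q′ : j′ ≤B n} {xs ys} →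
                xs ≋s ys → cast 𝒜 e p q (F i p xs) ≋ cast 𝒜 e′ p′ q′ (F j p′ ys)
  cast-Node-≋ F e e′ xs≋ys =
    ≋-trans (≋-sym (≋-cast e _ _ _)) (≋-trans (Node-≋ F _ _ xs≋ys) (≋-cast e′ _ _ _))

module Semantics {Sig : Signature} {n : Bound} (𝒜 : Algebra Sig n) {X : Set}
                 (k : ℕ) .(pk : k ≤B n) (ι : X → C 𝒜 k pk) where
  open Eval 𝒜 k pk ι public
  open DepthCast 𝒜

  lookup-⟦⟧s : ∀ {m p} (ts : Vec (Term Sig X m) p) .(q : k + m ≤B n) i →
               lookup (⟦ ts ⟧s q) i ≡ ⟦ lookup ts i ⟧ q
  lookup-⟦⟧s (t ∷ ts) q zero    = refl
  lookup-⟦⟧s (t ∷ ts) q (suc i) = lookup-⟦⟧s ts q i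

  ⟦⟧s-cong : ∀ {m p} (ts us : Vec (Term Sig X m) p) .(q : k + m ≤B n) →
             (∀ i → ⟦ lookup ts i ⟧ q ≡ ⟦ lookup us i ⟧ q) → ⟦ ts ⟧s q ≡ ⟦ us ⟧s q
  ⟦⟧s-cong []       []       q ts≈us = refl
  ⟦⟧s-cong (t ∷ ts) (u ∷ us) q ts≈us =
    cong₂ _∷_ (ts≈us zero) (⟦⟧s-cong ts us q (λ i → ts≈us (suc i)))

  ⟦⟧-subst-depth : ∀ {i j} (e : i ≡ j) (t : Term Sig X i) .(q : k + j ≤B n) →
                   ⟦ t ⟧ (≤B-≡ (cong (k +_) e) q) ≋ ⟦ subst (Term Sig X) e t ⟧ q
  ⟦⟧-subst-depth refl t q = refl , refl

lookup-tacts : ∀ {Sig X m p} (actX : Perm → X → X) π (ts : Vec (Term Sig X m) p) i →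
               lookup (tacts actX π ts) i ≡ tact actX π (lookup ts i)
lookup-tacts actX π (t ∷ ts) zero    = refl
lookup-tacts actX π (t ∷ ts) (suc i) = lookup-tacts actX π ts i

module Equivariance {Sig : Signature} {n : Bound} (𝒜 : Algebra Sig n) (X : NomSet)
                    (k : ℕ) .(pk : k ≤B n) (ι : Carrier X → C 𝒜 k pk)
                    (ι-equivariant : Equivariant X (A 𝒜 k pk) ι) where
  open Semantics 𝒜 k pk ι
  open DepthCast 𝒜 using (cast-act)

  mutual
    ⟦⟧-equivariant : ∀ {m} (t : Term Sig (Carrier X) m) .(q : k + m ≤B n) π →
                     ⟦ tact (act X) π t ⟧ q ≡ act (A 𝒜 (k + m) q) π (⟦ t ⟧ q)
    ⟦⟧-equivariant (var x) q π =
      trans (cong (cast 𝒜 _ pk q) (ι-equivariant π x)) (cast-act _ pk q π (ι x))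
    ⟦⟧-equivariant (op f ts) q π =
      trans (cong (cast 𝒜 _ _ q)
              (trans (cong (op₀ 𝒜 f _ _) (⟦⟧s-equivariant ts _ π)) (op₀-equiv 𝒜 f _ _ π _)))
            (cast-act _ _ q π _)
    ⟦⟧-equivariant (fop g a ts) q π =
      trans (cong (cast 𝒜 _ _ q)
              (trans (cong (opf 𝒜 g _ _ (fun π a)) (⟦⟧s-equivariant ts _ π)) (opf-equiv 𝒜 g _ _ π a _)))
            (cast-act _ _ q π _)
    ⟦⟧-equivariant (νop h a ts) q π =
      trans (cong (cast 𝒜 _ _ q)
              (trans (cong (opb 𝒜 h _ _ (fun π a)) (⟦⟧s-equivariant ts _ π)) (opb-equiv 𝒜 h _ _ π a _)))
            (cast-act _ _ q π _)

    ⟦⟧s-equivariant : ∀ {m p} (ts : Vec (Term Sig (Carrier X) m) p) .(q : k + m ≤B n) π →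
                      ⟦ tacts (act X) π ts ⟧s q ≡ vact (act (A 𝒜 (k + m) q)) π (⟦ ts ⟧s q)
    ⟦⟧s-equivariant []       q π = refl
    ⟦⟧s-equivariant (t ∷ ts) q π = cong₂ _∷_ (⟦⟧-equivariant t q π) (⟦⟧s-equivariant ts q π)

  ⟦⟧∘-equivariant : ∀ {Y : NomSet} {l} (σ : Carrier Y → Term Sig (Carrier X) l) .(q : k + l ≤B n) →
                    (∀ π y → ⟦ tact (act X) π (σ y) ⟧ q ≡ ⟦ σ (act Y π y) ⟧ q) →
                    Equivariant Y (A 𝒜 (k + l) q) (λ y → ⟦ σ y ⟧ q)
  ⟦⟧∘-equivariant σ q σ-equivariant π y = trans (sym (σ-equivariant π y)) (⟦⟧-equivariant (σ y) q π)

  ⟦⟧s-Fresh : ∀ {m p a} (ts : Vec (Term Sig (Carrier X) m) p) .(q : k + m ≤B n) →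
              (∀ i → Fresh (tact (act X)) a (lookup ts i)) →
              Fresh (vact (act (A 𝒜 (k + m) q))) a (⟦ ts ⟧s q)
  ⟦⟧s-Fresh {m} ts q a#ts = Fresh-vec (⟦ ts ⟧s q) λ i →
    subst (Fresh (act N) _) (sym (lookup-⟦⟧s ts q i)) (⟦⟧-Fresh (lookup ts i) (a#ts i))
    where
    N : NomSet
    N = A 𝒜 (k + m) q
    ⟦⟧-Fresh : ∀ {a} t → Fresh (tact (act X)) a t → Fresh (act N) a (⟦ t ⟧ q)
    ⟦⟧-Fresh t (S , a∉S , supp) =
      S , a∉S , λ ρ ρ-fixes →
        trans (sym (⟦⟧-equivariant t q ρ)) (cong (λ t′ → ⟦ t′ ⟧ q) (supp ρ ρ-fixes))

  ⟦⟧-νop-rename : ∀ {m} h a b (ts us : Vec (Term Sig (Carrier X) m) (ar Sig h))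
                  .(q : k + m + dep Sig h ≤B n) →
                  (∀ i → Fresh (tact (act X)) a (lookup us i)) →
                  (∀ i → ⟦ lookup ts i ⟧ (≤B-+ˡ q) ≡ ⟦ tact (act X) (swap a b) (lookup us i) ⟧ (≤B-+ˡ q)) →
                  opb 𝒜 h (k + m) q a (⟦ ts ⟧s (≤B-+ˡ q)) ≡ opb 𝒜 h (k + m) q b (⟦ us ⟧s (≤B-+ˡ q))
  ⟦⟧-νop-rename {m} h a b ts us q a#us ts≈us = begin
    opb 𝒜 h (k + m) q a (⟦ ts ⟧s _)
      ≡⟨ cong (opb 𝒜 h (k + m) q a) (⟦⟧s-cong ts (tacts (act X) (swap a b) us) _ λ i →
           trans (ts≈us i) (cong (λ t → ⟦ t ⟧ _) (sym (lookup-tacts (act X) (swap a b) us i)))) ⟩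
    opb 𝒜 h (k + m) q a (⟦ tacts (act X) (swap a b) us ⟧s _)
      ≡⟨ cong (opb 𝒜 h (k + m) q a) (⟦⟧s-equivariant us _ (swap a b)) ⟩
    opb 𝒜 h (k + m) q a (vact (act (A 𝒜 (k + m) _)) (swap a b) (⟦ us ⟧s _))
      ≡⟨ opb-rename 𝒜 h (k + m) q a b (⟦ us ⟧s _) (⟦⟧s-Fresh us _ a#us) ⟩
    opb 𝒜 h (k + m) q b (⟦ us ⟧s _) ∎
    where open ≡-Reasoning

module Substitution {Sig : Signature} {n : Bound} (𝒜 : Algebra Sig n) {Y X : Set}
                    (k : ℕ) .(pk : k ≤B n) (ι : X → C 𝒜 k pk)
                    (l : ℕ) .(pkl : k + l ≤B n) (σ : Y → Term Sig X l) where
  open Semantics 𝒜 k pk ι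
  open DepthCast 𝒜

  ισ : Y → C 𝒜 (k + l) pkl
  ισ y = ⟦ σ y ⟧ pkl

  module ⟦σ⟧ = Eval 𝒜 (k + l) pkl ισ

  mutual
    ⟦⟧-subst : ∀ {m} (t : Term Sig Y m) .(q : k + (m + l) ≤B n) .(q′ : k + l + m ≤B n) →
               ⟦σ⟧.⟦ t ⟧ q′ ≋ ⟦ t [ σ ] ⟧ q
    ⟦⟧-subst (var y) q q′ = ≋-sym (≋-cast _ pkl q′ (ισ y))
    ⟦⟧-subst (op {m} f ts) q q′ =
      ≋-trans (cast-Node-≋ (op₀ 𝒜 f) _ _ (⟦⟧s-subst ts _ _))
              (⟦⟧-subst-depth (+-shuffle m l (dep Sig f)) (op f (_⟪σ⟫s σ ts)) q)
    ⟦⟧-subst (fop {m} g a ts) q q′ =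
      ≋-trans (cast-Node-≋ (λ i p → opf 𝒜 g i p a) _ _ (⟦⟧s-subst ts _ _))
              (⟦⟧-subst-depth (+-shuffle m l (dep Sig g)) (fop g a (_⟪σ⟫s σ ts)) q)
    ⟦⟧-subst (νop {m} h a ts) q q′ =
      ≋-trans (cast-Node-≋ (λ i p → opb 𝒜 h i p a) _ _ (⟦⟧s-subst ts _ _))
              (⟦⟧-subst-depth (+-shuffle m l (dep Sig h)) (νop h a (_⟪σ⟫s σ ts)) q)

    ⟦⟧s-subst : ∀ {m p} (ts : Vec (Term Sig Y m) p) .(q : k + (m + l) ≤B n) .(q′ : k + l + m ≤B n) →
                ⟦σ⟧.⟦ ts ⟧s q′ ≋s ⟦ _⟪σ⟫s σ ts ⟧s q
    ⟦⟧s-subst {m} []   q q′ = ≋s-[] {p = q′} {q} (trans (+-assoc k l m) (cong (k +_) (+-comm l m)))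
    ⟦⟧s-subst (t ∷ ts) q q′ = ≋s-∷ (⟦⟧-subst t q q′) (⟦⟧s-subst ts q q′)

module _ {Sig : Signature} {n : Bound} (𝒜 : Algebra Sig n) where
  open DepthCast 𝒜

  Satisfies-tact : ∀ {X : NomSet} {m} t u τ → Satisfies 𝒜 X m t u →
                   Satisfies 𝒜 X m (tact (act X) τ t) (tact (act X) τ u)
  Satisfies-tact {X} {m} t u τ t≈u k q ι ι-equivariant = begin
    ⟦ tact (act X) τ t ⟧ q     ≡⟨ ⟦⟧-equivariant t q τ ⟩
    act (A 𝒜 (k + m) q) τ (⟦ t ⟧ q) ≡⟨ cong (act (A 𝒜 (k + m) q) τ) (t≈u k q ι ι-equivariant) ⟩
    act (A 𝒜 (k + m) q) τ (⟦ u ⟧ q) ≡⟨ ⟦⟧-equivariant u q τ ⟨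
    ⟦ tact (act X) τ u ⟧ q     ∎
    where
    open ≡-Reasoning
    open Semantics 𝒜 k (≤B-+ˡ q) ι
    open Equivariance 𝒜 X k (≤B-+ˡ q) ι ι-equivariant

  Satisfies-subst : ∀ {Y : NomSet} {X : Set} {d} r s → Satisfies 𝒜 Y d r s →
                    ∀ k .(pk : k ≤B n) (ι : X → C 𝒜 k pk) l .(pkl : k + l ≤B n)
                    (σ : Carrier Y → Term Sig X l) →
                    Equivariant Y (A 𝒜 (k + l) pkl) (λ y → Eval.⟦_⟧ 𝒜 k pk ι (σ y) pkl) →
                    .(q : k + (d + l) ≤B n) →
                    Eval.⟦_⟧ 𝒜 k pk ι (r [ σ ]) q ≡ Eval.⟦_⟧ 𝒜 k pk ι (s [ σ ]) q
  Satisfies-subst {d = d} r s r≈s k pk ι l pkl σ ισ-equivariant q = begin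
    ⟦ r [ σ ] ⟧ q
      ≡⟨ ≋⇒cast≡ k+l+d≡ (⟦⟧-subst r q _) ⟨
    cast 𝒜 k+l+d≡ _ q (⟦σ⟧.⟦ r ⟧ _)
      ≡⟨ cong (cast 𝒜 k+l+d≡ _ q) (r≈s (k + l) (≤B-≡ k+l+d≡ q) ισ ισ-equivariant) ⟩
    cast 𝒜 k+l+d≡ _ q (⟦σ⟧.⟦ s ⟧ _)
      ≡⟨ ≋⇒cast≡ k+l+d≡ (⟦⟧-subst s q _) ⟩
    ⟦ s [ σ ] ⟧ q
      ∎
    where
    open ≡-Reasoning
    open Semantics 𝒜 k pk ι
    open Substitution 𝒜 k pk ι l pkl σ
    k+l+d≡ : k + l + d ≡ k + (d + l)
    k+l+d≡ = trans (+-assoc k l d) (cong (k +_) (+-comm l d))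

module _ {T : Theory} {n : Bound} (M : Model T n) where
  private
    𝒜 : Algebra (sig T) n
    𝒜 = alg M

  sound : ∀ {X m t u} → Derivable T X m t u → Satisfies 𝒜 X m t u
  sound (drefl x) k q ι ι-equivariant = refl
  sound (dsymm u≈t) k q ι ι-equivariant = sym (sound u≈t k q ι ι-equivariant)
  sound (dtrans t≈v v≈u) k q ι ι-equivariant =
    trans (sound t≈v k q ι ι-equivariant) (sound v≈u k q ι ι-equivariant)
  sound (dcong₀ f ts us ts≈us) k q ι ι-equivariant =
    cong (λ xs → cast 𝒜 _ _ q (op₀ 𝒜 f _ _ xs))
         (⟦⟧s-cong ts us _ λ i → sound (ts≈us i) k _ ι ι-equivariant)
    where open Semantics 𝒜 k (≤B-+ˡ q) ι
  sound (dcongf g a ts us ts≈us) k q ι ι-equivariant =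
    cong (λ xs → cast 𝒜 _ _ q (opf 𝒜 g _ _ a xs))
         (⟦⟧s-cong ts us _ λ i → sound (ts≈us i) k _ ι ι-equivariant)
    where open Semantics 𝒜 k (≤B-+ˡ q) ι
  sound (dcongb h a ts us ts≈us) k q ι ι-equivariant =
    cong (λ xs → cast 𝒜 _ _ q (opb 𝒜 h _ _ a xs))
         (⟦⟧s-cong ts us _ λ i → sound (ts≈us i) k _ ι ι-equivariant)
    where open Semantics 𝒜 k (≤B-+ˡ q) ι
  sound {X} (dax e τ l σ σ-equivariant) k q ι ι-equivariant =
    Satisfies-subst 𝒜 {Y} (tact (act Y) τ r) (tact (act Y) τ s) (Satisfies-tact 𝒜 {Y} r s τ (sat-ax M e))
      k _ ι l (≤B-mono (+-monoʳ-≤ k (m≤n+m l d)) q) σ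
      (⟦⟧∘-equivariant {Y} σ _ λ π y → sound (σ-equivariant π y) k _ ι ι-equivariant) q
    where
    open Equivariance 𝒜 X k (≤B-+ˡ q) ι ι-equivariant
    open Equation (axiom T e) renaming (Vars to Y; depth to d; lhs to r; rhs to s)
  sound {X} (dperm h a b ts us _ a#us ts≈us) k q ι ι-equivariant =
    cong (cast 𝒜 _ _ q)
         (⟦⟧-νop-rename h a b ts us _ a#us λ i → sound (ts≈us i) k _ ι ι-equivariant)
    where open Equivariance 𝒜 X k (≤B-+ˡ q) ι ι-equivariant

theorem1 : (T : Theory) (X : NomSet) (m : ℕ)
           (t u : Term (sig T) (Carrier X) m) →
           Derivable T X m t u →
           (n : Bound) (M : Model T n) → Satisfies (alg M) X m t u
theorem1 T X m t u t≈u n M = sound M t≈u
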